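{- Let $p>3$ be a prime. For integers $1\le j,k\le p-1$ put $$\alpha=\min(j,k,p-j,p-k),\quad \delta=\min(\max(j,k),\max(p-j,p-k)),\quad \delta_1=\min(\delta,p-\delta),$$ $$GB(j,k)=\min\left(\frac{p-1}{2}+\alpha,\ p-\delta_1\right),\qquad BB(j,k)=\min(2\alpha+\delta_1,\ p-\delta_1).$$ Let $N_{GB}(p)$ be the number of pairs $(j,k)$ with $1\le j,k\le p-1$ and $GB(j,k)\le 2p/3$, and $N_{BB}(p)$ the number of such pairs with $BB(j,k)\le 2p/3$. Then $$N_{GB}(p)=\begin{cases}\frac{8}{9}p^2-\frac{16}{9}p+\frac{8}{9} & \text{if } p\equiv 1\pmod 3,\\ \frac{8}{9}p^2-\frac{8}{9}p-\frac{16}{9} & \text{if } p\equiv 2\pmod 3,\end{cases}$$ and $$N_{BB}(p)=\begin{cases}\frac{25}{27}p^2-\left(\frac{8}{27}\left(\frac{p}{3}\right)+2\right)p+\frac{73}{27} & \text{if } p\equiv \pm 2\pmod 9,\\ \frac{25}{27}p^2-\left(\frac{8}{27}\left(\frac{p}{3}\right)+2\right)p+\frac{37}{27} & \text{otherwise},\end{cases}$$ where $\left(\frac{p}{3}\right)$ is the Legendre symbol. -}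

module Defs where

open import Data.Nat using (ℕ; suc; _+_; _*_; _∸_; _≤_; _≤?_; _⊓_; _⊔_)
open import Data.Nat.DivMod using (_/_; _%_)
open import Data.Integer using (ℤ; +_; -_)
open import Data.List using (List; upTo; map; concatMap; filter; length)
open import Data.Product using (_×_; _,_)

α : ℕ → ℕ → ℕ → ℕ
α p j k = (j ⊓ k) ⊓ ((p ∸ j) ⊓ (p ∸ k))

δ : ℕ → ℕ → ℕ → ℕ
δ p j k = (j ⊔ k) ⊓ ((p ∸ j) ⊔ (p ∸ k))

δ₁ : ℕ → ℕ → ℕ → ℕ
δ₁ p j k = δ p j k ⊓ (p ∸ δ p j k)

-- GB(j,k) = min((p-1)/2 + α, p - δ₁); for odd p, (p-1)/2 is an integer
GB : ℕ → ℕ → ℕ → ℕ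
GB p j k = (((p ∸ 1) / 2) + α p j k) ⊓ (p ∸ δ₁ p j k)

BB : ℕ → ℕ → ℕ → ℕ
BB p j k = (2 * α p j k + δ₁ p j k) ⊓ (p ∸ δ₁ p j k)

pairs : ℕ → List (ℕ × ℕ)
pairs p = concatMap (λ j → map (λ k → (j , k)) range) range
  where
  range : List ℕ
  range = map suc (upTo (p ∸ 1))

-- x ≤ 2p/3  ⇔  3x ≤ 2p  (over the rationals, x natural)
N-GB : ℕ → ℕ
N-GB p = length (filter (λ { (j , k) → 3 * GB p j k ≤? 2 * p }) (pairs p))

N-BB : ℕ → ℕ
N-BB p = length (filter (λ { (j , k) → 3 * BB p j k ≤? 2 * p }) (pairs p))

legendre3 : ℕ → ℤ
legendre3 p with p % 3
... | 0 = + 0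
... | 1 = + 1
... | _ = - (+ 1)

module Submission where

-- GB and BB depend on (j, k) only through the distances a = min(j, p - j) and
-- b = min(k, p - k), since α = min(a, b) and δ₁ = max(a, b).  For p = 2h + 1 the map
-- j ↦ min(j, p - j) is two-to-one from [1, 2h] onto [1, h], so each count is four times
-- a count over the square [1, h]² (Folding).  With M = ⌊(p - 1)/3⌋ and T = ⌊2p/3⌋ the
-- test 3 min(w, p - max(a, b)) ≤ 2p reads "w ≤ T or max(a, b) > M" (Thresholds), and
-- the complement is easy to count:
--   * for GB, w = h + min(a, b), the complement is the square (g, M]² with g = T - h;
--   * for BB, w = 2 min(a, b) + max(a, b), it is a staircase in [1, M]², counted hook
--     by hook along the diagonal.
-- Writing the prime as p = 6d + 4e + 1 (e ∈ {0, 1}) and d = 3n + c (c < 3), this gives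
-- N-GB + 4d² = 4h² and N-BB + 4(2n(n + 1) + (2n + c)²) = 4h² in ℕ (ResidueClasses).
-- These identities are carried to ℚ along ι : ℕ → ℚ, where the ring solver matches them
-- with the closed forms of the theorem, one residue class of p modulo 18 at a time.

module FiniteSums where

  open import Data.Nat using (ℕ; zero; suc; _+_; _*_; _∸_; _≤_; _<_; _≤?_; z≤n; s≤s; z<s; s<s)
  open import Data.Nat.Properties
  open import Data.Nat.Tactic.RingSolver using (solve-∀)
  open import Algebra.Properties.CommutativeSemigroup +-commutativeSemigroup
    using () renaming (interchange to +-interchange)
  open import Data.Product using (_,_)
  open import Relation.Binary.PropositionalEquality
  open import Relation.Nullary using (Dec; yes; no; ¬_)
  open import Relation.Nullary.Decidable using (_×-dec_)
  open import Relation.Nullary.Negation using (contradiction)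
  open ≡-Reasoning

  ∑ : ℕ → (ℕ → ℕ) → ℕ
  ∑ zero    f = 0
  ∑ (suc n) f = f 0 + ∑ n (λ i → f (suc i))

  ∑² : ℕ → (ℕ → ℕ → ℕ) → ℕ
  ∑² n f = ∑ n (λ i → ∑ n (f i))

  ∑-cong : ∀ n {f g : ℕ → ℕ} → (∀ i → i < n → f i ≡ g i) → ∑ n f ≡ ∑ n g
  ∑-cong zero    eq = refl
  ∑-cong (suc n) eq = cong₂ _+_ (eq 0 z<s) (∑-cong n (λ i i<n → eq (suc i) (s<s i<n)))

  ∑²-cong : ∀ n {f g : ℕ → ℕ → ℕ} → (∀ i j → i < n → j < n → f i j ≡ g i j) →
    ∑² n f ≡ ∑² n g
  ∑²-cong n eq = ∑-cong n (λ i i<n → ∑-cong n (λ j j<n → eq i j i<n j<n))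

  ∑-const : ∀ n c → ∑ n (λ _ → c) ≡ n * c
  ∑-const zero    c = refl
  ∑-const (suc n) c = cong (c +_) (∑-const n c)

  ∑-vanishes : ∀ n {f} → (∀ i → i < n → f i ≡ 0) → ∑ n f ≡ 0
  ∑-vanishes n eq = trans (∑-cong n eq) (trans (∑-const n 0) (*-zeroʳ n))

  ∑-+ : ∀ n f g → ∑ n (λ i → f i + g i) ≡ ∑ n f + ∑ n g
  ∑-+ zero    f g = refl
  ∑-+ (suc n) f g =
    trans (cong (f 0 + g 0 +_) (∑-+ n (λ i → f (suc i)) (λ i → g (suc i))))
          (+-interchange (f 0) (g 0) _ _)

  ∑-* : ∀ n k f → ∑ n (λ i → k * f i) ≡ k * ∑ n f
  ∑-* zero    k f = sym (*-zeroʳ k)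
  ∑-* (suc n) k f =
    trans (cong (k * f 0 +_) (∑-* n k (λ i → f (suc i)))) (sym (*-distribˡ-+ k (f 0) _))

  ∑-split : ∀ m n f → ∑ (m + n) f ≡ ∑ m f + ∑ n (λ i → f (m + i))
  ∑-split zero    n f = refl
  ∑-split (suc m) n f =
    trans (cong (f 0 +_) (∑-split m n (λ i → f (suc i)))) (sym (+-assoc (f 0) _ _))

  ∑-last : ∀ n f → ∑ (suc n) f ≡ ∑ n f + f n
  ∑-last zero    f = +-comm (f 0) 0
  ∑-last (suc n) f =
    trans (cong (f 0 +_) (∑-last n (λ i → f (suc i)))) (sym (+-assoc (f 0) _ _))

  ∑-reverse : ∀ n f → ∑ n (λ i → f (n ∸ suc i)) ≡ ∑ n f
  ∑-reverse zero    f = refl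
  ∑-reverse (suc n) f =
    trans (cong (f n +_) (∑-reverse n f)) (trans (+-comm (f n) _) (sym (∑-last n f)))

  ∑-truncate : ∀ m h {f g} → m ≤ h → (∀ i → i < m → f i ≡ g i) → (∀ i → m ≤ i → f i ≡ 0) →
    ∑ h f ≡ ∑ m g
  ∑-truncate m h {f} {g} m≤h agree vanish with m≤n⇒∃[o]m+o≡n m≤h
  ... | k , refl = begin
    ∑ (m + k) f
      ≡⟨ ∑-split m k f ⟩
    ∑ m f + ∑ k (λ i → f (m + i))
      ≡⟨ cong₂ _+_ (∑-cong m agree) (∑-vanishes k (λ i _ → vanish (m + i) (m≤m+n m i))) ⟩
    ∑ m g + 0
      ≡⟨ +-identityʳ _ ⟩
    ∑ m g ∎

  ∑-odd : ∀ n → ∑ n (λ i → 1 + 2 * i) ≡ n * n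
  ∑-odd zero    = refl
  ∑-odd (suc n) = begin
    ∑ (suc n) (λ i → 1 + 2 * i)        ≡⟨ ∑-last n _ ⟩
    ∑ n (λ i → 1 + 2 * i) + (1 + 2 * n) ≡⟨ cong (_+ (1 + 2 * n)) (∑-odd n) ⟩
    n * n + (1 + 2 * n)                ≡⟨ square-step n ⟩
    suc n * suc n                      ∎
    where
    square-step : ∀ n → n * n + (1 + 2 * n) ≡ suc n * suc n
    square-step = solve-∀

  ∑-triangle : ∀ n → 2 * ∑ n suc ≡ n * (n + 1)
  ∑-triangle zero    = refl
  ∑-triangle (suc n) = begin
    2 * ∑ (suc n) suc                  ≡⟨ cong (2 *_) (∑-last n suc) ⟩
    2 * (∑ n suc + suc n)              ≡⟨ *-distribˡ-+ 2 (∑ n suc) (suc n) ⟩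
    2 * ∑ n suc + 2 * suc n            ≡⟨ cong (_+ 2 * suc n) (∑-triangle n) ⟩
    n * (n + 1) + 2 * suc n            ≡⟨ triangle-step n ⟩
    suc n * (suc n + 1)                ∎
    where
    triangle-step : ∀ n → n * (n + 1) + 2 * suc n ≡ suc n * (suc n + 1)
    triangle-step = solve-∀

  χ : ∀ {P : Set} → Dec P → ℕ
  χ (yes _) = 1
  χ (no  _) = 0

  χ≤1 : ∀ {P : Set} (p : Dec P) → χ p ≤ 1
  χ≤1 (yes _) = s≤s z≤n
  χ≤1 (no  _) = z≤n

  χ-no : ∀ {P : Set} (p : Dec P) → ¬ P → χ p ≡ 0
  χ-no (yes x) ¬x = contradiction x ¬x
  χ-no (no  _) _  = refl

  χ-yes : ∀ {P : Set} (p : Dec P) → P → χ p ≡ 1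
  χ-yes (yes _) _ = refl
  χ-yes (no ¬x) x = contradiction x ¬x

  χ-cong : ∀ {P Q : Set} (p : Dec P) (q : Dec Q) → (P → Q) → (Q → P) → χ p ≡ χ q
  χ-cong (yes _) (yes _) _ _ = refl
  χ-cong (yes x) (no ¬y) f _ = contradiction (f x) ¬y
  χ-cong (no ¬x) (yes y) _ g = contradiction (g y) ¬x
  χ-cong (no  _) (no  _) _ _ = refl

  χ-complement : ∀ {P Q : Set} (p : Dec P) (q : Dec Q) → (P → ¬ Q) → (¬ P → Q) → χ p ≡ 1 ∸ χ q
  χ-complement (yes x) (yes y) f _ = contradiction y (f x)
  χ-complement (yes _) (no  _) _ _ = refl
  χ-complement (no  _) (yes _) _ _ = refl
  χ-complement (no ¬x) (no ¬y) _ g = contradiction (g ¬x) ¬y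

  χ-× : ∀ {P Q : Set} (p : Dec P) (q : Dec Q) → χ (p ×-dec q) ≡ χ p * χ q
  χ-× (yes _) (yes _) = refl
  χ-× (yes _) (no  _) = refl
  χ-× (no  _) _       = refl

  count-≥ : ∀ n s → ∑ n (λ i → χ (s ≤? i)) ≡ n ∸ s
  count-≥ zero    s = sym (0∸n≡0 s)
  count-≥ (suc n) s = begin
    ∑ (suc n) (λ i → χ (s ≤? i))       ≡⟨ ∑-last n _ ⟩
    ∑ n (λ i → χ (s ≤? i)) + χ (s ≤? n) ≡⟨ cong (_+ χ (s ≤? n)) (count-≥ n s) ⟩
    n ∸ s + χ (s ≤? n)                 ≡⟨ step (s ≤? n) ⟩
    suc n ∸ s                          ∎
    where
    step : (d : Dec (s ≤ n)) → n ∸ s + χ d ≡ suc n ∸ s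
    step (yes s≤n) = trans (+-comm (n ∸ s) 1) (sym (+-∸-assoc 1 s≤n))
    step (no  s≰n) = trans (+-identityʳ _) (trans (m≤n⇒m∸n≡0 (<⇒≤ n<s)) (sym (m≤n⇒m∸n≡0 n<s)))
      where n<s = ≰⇒> s≰n

  ∑²-complement : ∀ n (Z : ℕ → ℕ → ℕ) → (∀ a b → Z a b ≤ 1) →
    ∑² n (λ a b → 1 ∸ Z a b) + ∑² n Z ≡ n * n
  ∑²-complement n Z Z≤1 = begin
    ∑² n (λ a b → 1 ∸ Z a b) + ∑² n Z
      ≡⟨ ∑-+ n _ _ ⟨
    ∑ n (λ a → ∑ n (λ b → 1 ∸ Z a b) + ∑ n (Z a))
      ≡⟨ ∑-cong n (λ a _ → trans (sym (∑-+ n _ _)) (row a)) ⟩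
    ∑ n (λ _ → n)
      ≡⟨ ∑-const n n ⟩
    n * n ∎
    where
    row : ∀ a → ∑ n (λ b → (1 ∸ Z a b) + Z a b) ≡ n
    row a = trans (∑-cong n (λ b _ → m∸n+n≡m (Z≤1 a b))) (trans (∑-const n 1) (*-identityʳ n))

  count-by-complement : ∀ n k N (G Z : ℕ → ℕ → ℕ) → N ≡ k * ∑² n G →
    (∀ a b → G a b ≡ 1 ∸ Z a b) → (∀ a b → Z a b ≤ 1) → N + k * ∑² n Z ≡ k * (n * n)
  count-by-complement n k N G Z refl G≡1∸Z Z≤1 = begin
    k * ∑² n G + k * ∑² n Z
      ≡⟨ *-distribˡ-+ k (∑² n G) (∑² n Z) ⟨
    k * (∑² n G + ∑² n Z)
      ≡⟨ cong (λ s → k * (s + ∑² n Z)) (∑²-cong n (λ a b _ _ → G≡1∸Z a b)) ⟩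
    k * (∑² n (λ a b → 1 ∸ Z a b) + ∑² n Z)
      ≡⟨ cong (k *_) (∑²-complement n Z Z≤1) ⟩
    k * (n * n) ∎

  ∑²-product : ∀ n f → ∑² n (λ a b → f a * f b) ≡ ∑ n f * ∑ n f
  ∑²-product n f = begin
    ∑ n (λ a → ∑ n (λ b → f a * f b)) ≡⟨ ∑-cong n (λ a _ → ∑-* n (f a) f) ⟩
    ∑ n (λ a → f a * ∑ n f)           ≡⟨ ∑-cong n (λ a _ → *-comm (f a) _) ⟩
    ∑ n (λ a → ∑ n f * f a)           ≡⟨ ∑-* n (∑ n f) f ⟩
    ∑ n f * ∑ n f                     ∎

  ∑²-peel : ∀ n f → (∀ i j → f i j ≡ f j i) →
    ∑² (suc n) f ≡ (f 0 0 + 2 * ∑ n (λ j → f 0 (suc j))) + ∑² n (λ i j → f (suc i) (suc j))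
  ∑²-peel n f f-sym = begin
    (f 0 0 + R) + ∑ n (λ i → f (suc i) 0 + ∑ n (λ j → f (suc i) (suc j)))
      ≡⟨ cong ((f 0 0 + R) +_) (∑-+ n _ _) ⟩
    (f 0 0 + R) + (∑ n (λ i → f (suc i) 0) + F)
      ≡⟨ cong (λ C → (f 0 0 + R) + (C + F)) (∑-cong n (λ i _ → f-sym (suc i) 0)) ⟩
    (f 0 0 + R) + (R + F)
      ≡⟨ regroup (f 0 0) R F ⟩
    (f 0 0 + 2 * R) + F ∎
    where
    R = ∑ n (λ j → f 0 (suc j))
    F = ∑² n (λ i j → f (suc i) (suc j))
    regroup : ∀ a r x → (a + r) + (r + x) ≡ (a + 2 * r) + x
    regroup = solve-∀

  ∑²-hooks : ∀ n f → (∀ i j → f i j ≡ f j i) →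
    ∑² n f ≡ ∑ n (λ i → f i i + 2 * ∑ (n ∸ suc i) (λ j → f i (suc i + j)))
  ∑²-hooks zero    f f-sym = refl
  ∑²-hooks (suc n) f f-sym =
    trans (∑²-peel n f f-sym) (cong (f 0 0 + 2 * ∑ n (λ j → f 0 (suc j)) +_)
      (∑²-hooks n (λ i j → f (suc i) (suc j)) (λ i j → f-sym (suc i) (suc j))))

module PairCounting where

  open import Data.Nat using (ℕ; zero; suc; _+_)
  open import Data.Product using (_×_; _,_)
  open import Data.List using (List; _++_; map; filter; length; concatMap; applyUpTo; upTo)
  open import Data.List.Properties using (length-++; filter-++; map-upTo; map-applyUpTo)
  open import Relation.Binary.PropositionalEquality
  open import Relation.Nullary using (yes; no)
  open import Relation.Unary using (Pred; Decidable)
  open import Level using (0ℓ)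
  open import Defs using (pairs)
  open FiniteSums
  open ≡-Reasoning

  count-applyUpTo : ∀ {A : Set} {P : Pred A 0ℓ} (P? : Decidable P) n (f : ℕ → A) →
    length (filter P? (applyUpTo f n)) ≡ ∑ n (λ i → χ (P? (f i)))
  count-applyUpTo P? zero    f = refl
  count-applyUpTo P? (suc n) f with P? (f 0)
  ... | yes _ = cong suc (count-applyUpTo P? n (λ i → f (suc i)))
  ... | no  _ = count-applyUpTo P? n (λ i → f (suc i))

  count-concatMap : ∀ {A : Set} {P : Pred A 0ℓ} (P? : Decidable P) n (f : ℕ → ℕ) (g : ℕ → List A) →
    length (filter P? (concatMap g (applyUpTo f n))) ≡ ∑ n (λ i → length (filter P? (g (f i))))
  count-concatMap P? zero    f g = refl
  count-concatMap P? (suc n) f g = begin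
    length (filter P? (g (f 0) ++ rest))
      ≡⟨ cong length (filter-++ P? (g (f 0)) rest) ⟩
    length (filter P? (g (f 0)) ++ filter P? rest)
      ≡⟨ length-++ (filter P? (g (f 0))) ⟩
    length (filter P? (g (f 0))) + length (filter P? rest)
      ≡⟨ cong (length (filter P? (g (f 0))) +_) (count-concatMap P? n (λ i → f (suc i)) g) ⟩
    ∑ (suc n) (λ i → length (filter P? (g (f i)))) ∎
    where rest = concatMap g (applyUpTo (λ i → f (suc i)) n)

  count-pairs : ∀ {P : Pred (ℕ × ℕ) 0ℓ} (P? : Decidable P) n →
    length (filter P? (pairs (suc n))) ≡ ∑² n (λ i j → χ (P? (suc i , suc j)))
  count-pairs P? n = begin
    length (filter P? (concatMap (λ j → map (j ,_) (map suc (upTo n))) (map suc (upTo n))))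
      ≡⟨ cong (λ R → length (filter P? (concatMap (λ j → map (j ,_) R) R))) (map-upTo suc n) ⟩
    length (filter P? (concatMap (λ j → map (j ,_) (applyUpTo suc n)) (applyUpTo suc n)))
      ≡⟨ count-concatMap P? n suc _ ⟩
    ∑ n (λ i → length (filter P? (map (suc i ,_) (applyUpTo suc n))))
      ≡⟨ ∑-cong n (λ i _ → cong (λ xs → length (filter P? xs)) (map-applyUpTo suc (suc i ,_) n)) ⟩
    ∑ n (λ i → length (filter P? (applyUpTo (λ j → suc i , suc j) n)))
      ≡⟨ ∑-cong n (λ i _ → count-applyUpTo P? n _) ⟩
    ∑² n (λ i j → χ (P? (suc i , suc j))) ∎

module Folding where

  open import Data.Nat using (ℕ; suc; _+_; _*_; _∸_; _≤_; _<_; _⊓_; _⊔_; s≤s)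
  open import Data.Nat.Properties
  open import Data.Sum using (inj₁; inj₂)
  open import Relation.Binary.PropositionalEquality
  open import Algebra.Properties.CommutativeSemigroup ⊓-commutativeSemigroup
    using () renaming (interchange to ⊓-interchange)
  open import Defs using (α; δ; δ₁)
  open FiniteSums
  open ≡-Reasoning

  dist : ℕ → ℕ → ℕ
  dist p x = x ⊓ (p ∸ x)

  α≡ : ∀ p j k → α p j k ≡ dist p j ⊓ dist p k
  α≡ p j k = ⊓-interchange j k (p ∸ j) (p ∸ k)

  reflect-≤ : ∀ p {x y} → x ≤ p ∸ y → y ≤ p → y ≤ p ∸ x
  reflect-≤ p {x} x≤p-y y≤p = subst (_≤ p ∸ x) (m∸[m∸n]≡n y≤p) (∸-monoʳ-≤ p x≤p-y)

  reflect-≥ : ∀ p {x y} → p ∸ y ≤ x → y ≤ p → p ∸ x ≤ y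
  reflect-≥ p {x} p-y≤x y≤p = subst (p ∸ x ≤_) (m∸[m∸n]≡n y≤p) (∸-monoʳ-≤ p p-y≤x)

  δ₁-ordered : ∀ p j k → j ≤ p → j ≤ k → δ₁ p j k ≡ dist p j ⊔ dist p k
  δ₁-ordered p j k j≤p j≤k with ≤-total k (p ∸ j)
  ... | inj₁ k≤p-j = begin
    δ p j k ⊓ (p ∸ δ p j k) ≡⟨ cong (λ z → z ⊓ (p ∸ z)) (trans δ≡ (m≤n⇒m⊓n≡m k≤p-j)) ⟩
    dist p k                ≡⟨ m≤n⇒m⊔n≡n dist-j≤dist-k ⟨
    dist p j ⊔ dist p k     ∎
    where
    δ≡ : δ p j k ≡ k ⊓ (p ∸ j)
    δ≡ = cong₂ _⊓_ (m≤n⇒m⊔n≡n j≤k) (m≥n⇒m⊔n≡m (∸-monoʳ-≤ p j≤k))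
    dist-j≤dist-k : dist p j ≤ dist p k
    dist-j≤dist-k = ⊓-glb (≤-trans (m⊓n≤m j _) j≤k) (≤-trans (m⊓n≤m j _) (reflect-≤ p k≤p-j j≤p))
  ... | inj₂ p-j≤k = begin
    δ p j k ⊓ (p ∸ δ p j k) ≡⟨ cong (λ z → z ⊓ (p ∸ z)) (trans δ≡ (m≥n⇒m⊓n≡n p-j≤k)) ⟩
    (p ∸ j) ⊓ (p ∸ (p ∸ j)) ≡⟨ cong ((p ∸ j) ⊓_) (m∸[m∸n]≡n j≤p) ⟩
    (p ∸ j) ⊓ j             ≡⟨ ⊓-comm (p ∸ j) j ⟩
    dist p j                ≡⟨ m≥n⇒m⊔n≡m dist-k≤dist-j ⟨
    dist p j ⊔ dist p k     ∎
    where
    δ≡ : δ p j k ≡ k ⊓ (p ∸ j)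
    δ≡ = cong₂ _⊓_ (m≤n⇒m⊔n≡n j≤k) (m≥n⇒m⊔n≡m (∸-monoʳ-≤ p j≤k))
    dist-k≤dist-j : dist p k ≤ dist p j
    dist-k≤dist-j = ⊓-glb (≤-trans (m⊓n≤n k _) (reflect-≥ p p-j≤k j≤p))
                          (≤-trans (m⊓n≤n k _) (∸-monoʳ-≤ p j≤k))

  δ₁≡ : ∀ p j k → j ≤ p → k ≤ p → δ₁ p j k ≡ dist p j ⊔ dist p k
  δ₁≡ p j k j≤p k≤p with ≤-total j k
  ... | inj₁ j≤k = δ₁-ordered p j k j≤p j≤k
  ... | inj₂ k≤j = begin
    δ₁ p j k
      ≡⟨ cong (λ z → z ⊓ (p ∸ z)) (cong₂ _⊓_ (⊔-comm j k) (⊔-comm (p ∸ j) (p ∸ k))) ⟩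
    δ₁ p k j
      ≡⟨ δ₁-ordered p k j k≤p k≤j ⟩
    dist p k ⊔ dist p j
      ≡⟨ ⊔-comm (dist p k) (dist p j) ⟩
    dist p j ⊔ dist p k ∎

  -- For odd p = 2h + 1, x ↦ dist p x maps [1, 2h] two-to-one onto [1, h].
  ∑-fold : ∀ h (Φ : ℕ → ℕ) →
    ∑ (h + h) (λ i → Φ (dist (suc (h + h)) (suc i))) ≡ 2 * ∑ h (λ i → Φ (suc i))
  ∑-fold h Φ = begin
    ∑ (h + h) (λ i → Φ (dist p (suc i)))
      ≡⟨ ∑-split h h _ ⟩
    ∑ h (λ i → Φ (dist p (suc i))) + ∑ h (λ i → Φ (dist p (suc (h + i))))
      ≡⟨ cong₂ _+_ (∑-cong h lower-half)
                   (trans (∑-cong h upper-half) (∑-reverse h (λ i → Φ (suc i)))) ⟩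
    X + X
      ≡⟨ cong (X +_) (+-identityʳ X) ⟨
    2 * X ∎
    where
    p = suc (h + h)
    X = ∑ h (λ i → Φ (suc i))
    lower-half : ∀ i → i < h → Φ (dist p (suc i)) ≡ Φ (suc i)
    lower-half i i<h = cong Φ (m≤n⇒m⊓n≡m (≤-trans i<h h≤p-i))
      where
      h≤p-i : h ≤ (h + h) ∸ i
      h≤p-i = subst (h ≤_) (sym (+-∸-assoc h (<⇒≤ i<h))) (m≤m+n h _)
    upper-half : ∀ i → i < h → Φ (dist p (suc (h + i))) ≡ Φ (suc (h ∸ suc i))
    upper-half i i<h = cong Φ (begin
      suc (h + i) ⊓ ((h + h) ∸ (h + i)) ≡⟨ cong (suc (h + i) ⊓_) ([m+n]∸[m+o]≡n∸o h h i) ⟩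
      suc (h + i) ⊓ (h ∸ i)             ≡⟨ m≥n⇒m⊓n≡n (≤-trans (m∸n≤m h i) (m≤n⇒m≤1+n (m≤m+n h i))) ⟩
      h ∸ i                             ≡⟨ +-∸-assoc 1 i<h ⟩
      suc (h ∸ suc i)                   ∎)

  ∑²-fold : ∀ h (F G : ℕ → ℕ → ℕ) →
    (∀ j k → j ≤ suc (h + h) → k ≤ suc (h + h) →
       F j k ≡ G (dist (suc (h + h)) j) (dist (suc (h + h)) k)) →
    ∑² (h + h) (λ i j → F (suc i) (suc j)) ≡ 4 * ∑² h (λ a b → G (suc a) (suc b))
  ∑²-fold h F G F≡G = begin
    ∑² (h + h) (λ i j → F (suc i) (suc j))
      ≡⟨ ∑²-cong (h + h) (λ i j i< j< → F≡G (suc i) (suc j) (s≤s (<⇒≤ i<)) (s≤s (<⇒≤ j<))) ⟩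
    ∑ (h + h) (λ i → ∑ (h + h) (λ j → G (dist p (suc i)) (dist p (suc j))))
      ≡⟨ ∑-cong (h + h) (λ i _ → ∑-fold h (G (dist p (suc i)))) ⟩
    ∑ (h + h) (λ i → 2 * ∑ h (λ b → G (dist p (suc i)) (suc b)))
      ≡⟨ ∑-fold h (λ a → 2 * ∑ h (λ b → G a (suc b))) ⟩
    2 * ∑ h (λ a → 2 * ∑ h (λ b → G (suc a) (suc b)))
      ≡⟨ cong (2 *_) (∑-* h 2 _) ⟩
    2 * (2 * Y)
      ≡⟨ *-assoc 2 2 Y ⟨
    4 * Y ∎
    where
    p = suc (h + h)
    Y = ∑² h (λ a b → G (suc a) (suc b))

module Thresholds where

  open import Data.Nat using (ℕ; suc; _+_; _*_; _∸_; _≤_; _<_; _⊓_; s≤s⁻¹)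
  open import Data.Nat.Properties
  open import Data.Nat.Tactic.RingSolver using (solve-∀)
  open import Data.Product using (_×_; _,_; proj₁; proj₂)
  open import Data.Sum using (_⊎_; inj₁; inj₂) renaming (map to ⊎-map)
  open import Function.Bundles using (_⇔_; mk⇔; Equivalence)
  open import Relation.Binary.PropositionalEquality
  open Equivalence using (to; from)

  Third : ℕ → ℕ → Set
  Third q x = 3 * q ≤ x × x < 3 * suc q

  third-intro : ∀ {q x} r → x ≡ 3 * q + r → r < 3 → Third q x
  third-intro {q} r refl r<3 =
    m≤m+n (3 * q) r ,
    subst (3 * q + r <_) (trans (+-comm (3 * q) 3) (sym (*-suc 3 q))) (+-monoʳ-< (3 * q) r<3)

  third-≤ : ∀ {q x} → Third q x → ∀ w → 3 * w ≤ x ⇔ w ≤ q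
  third-≤ {q} (3q≤x , x<3q+3) w = mk⇔
    (λ 3w≤x → s≤s⁻¹ (*-cancelˡ-< 3 w (suc q) (≤-<-trans 3w≤x x<3q+3)))
    (λ w≤q → ≤-trans (*-monoʳ-≤ 3 w≤q) 3q≤x)

  third-of-double : ∀ {M h} → Third M (h + h) → M ≤ h
  third-of-double {M} {h} (3M≤2h , _) = ≮⇒≥ λ h<M →
    <⇒≱ (+-mono-< h<M h<M) (≤-trans (+-monoʳ-≤ M (m≤m+n M (M + 0))) 3M≤2h)

  ⊓-≤ : ∀ a b c → a ⊓ b ≤ c ⇔ (a ≤ c ⊎ b ≤ c)
  ⊓-≤ a b c = mk⇔ split join
    where
    join : a ≤ c ⊎ b ≤ c → a ⊓ b ≤ c
    join (inj₁ a≤c) = ≤-trans (m⊓n≤m a b) a≤c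
    join (inj₂ b≤c) = ≤-trans (m⊓n≤n a b) b≤c
    split : a ⊓ b ≤ c → a ≤ c ⊎ b ≤ c
    split le with ⊓-sel a b
    ... | inj₁ eq = inj₁ (subst (_≤ c) eq le)
    ... | inj₂ eq = inj₂ (subst (_≤ c) eq le)

  module Comparisons {x M T : ℕ} (M-third : Third M x) (T-third : Third T (2 * suc x)) where

    private p = suc x

    near : ∀ w → 3 * w ≤ 2 * p ⇔ w ≤ T
    near = third-≤ T-third

    far : ∀ v → 3 * (p ∸ v) ≤ 2 * p ⇔ M < v
    far v = mk⇔ (λ le → large⇒M< (large le)) (λ M<v → small (M<⇒large M<v))
      where
      triple-p : ∀ p → 3 * p ≡ p + 2 * p
      triple-p = solve-∀
      triple = triple-p p
      large : 3 * (p ∸ v) ≤ 2 * p → p ≤ 3 * v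
      large le = +-cancelʳ-≤ (2 * p) p (3 * v) (subst (_≤ 3 * v + 2 * p) triple (begin
        3 * p                   ≤⟨ m≤n+m∸n (3 * p) (3 * v) ⟩
        3 * v + (3 * p ∸ 3 * v) ≡⟨ cong (3 * v +_) (*-distribˡ-∸ 3 p v) ⟨
        3 * v + 3 * (p ∸ v)     ≤⟨ +-monoʳ-≤ (3 * v) le ⟩
        3 * v + 2 * p           ∎))
        where open ≤-Reasoning
      small : p ≤ 3 * v → 3 * (p ∸ v) ≤ 2 * p
      small p≤3v = subst (_≤ 2 * p) (sym (*-distribˡ-∸ 3 p v))
        (m≤n+o⇒m∸n≤o (3 * p) (3 * v) (subst (_≤ 3 * v + 2 * p) (sym triple) (+-monoˡ-≤ (2 * p) p≤3v)))
      large⇒M< : p ≤ 3 * v → M < v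
      large⇒M< p≤3v = *-cancelˡ-< 3 M v (≤-<-trans (proj₁ M-third) (<-≤-trans (n<1+n x) p≤3v))
      M<⇒large : M < v → p ≤ 3 * v
      M<⇒large M<v = ≤-trans (proj₂ M-third) (*-monoʳ-≤ 3 M<v)

    -- Both GB and BB have the form w ⊓ (p ∸ v).
    min-form : ∀ w v → 3 * (w ⊓ (p ∸ v)) ≤ 2 * p ⇔ (w ≤ T ⊎ M < v)
    min-form w v = mk⇔
      (λ le → ⊎-map (to (near w)) (to (far v)) (to split-min (subst (_≤ 2 * p) dist3 le)))
      (λ cases → subst (_≤ 2 * p) (sym dist3) (from split-min (⊎-map (from (near w)) (from (far v)) cases)))
      where
      dist3 = *-distribˡ-⊓ 3 w (p ∸ v)
      split-min = ⊓-≤ (3 * w) (3 * (p ∸ v)) (2 * p)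

module CountGB where

  open import Data.Nat using (ℕ; suc; _+_; _*_; _∸_; _≤_; _<_; _⊓_; _⊔_; _≤?_; _<?_; s≤s; s≤s⁻¹)
  open import Data.Nat.Properties
  open import Data.Nat.DivMod using (_/_; m*n/n≡m)
  open import Data.Product using (_×_; _,_)
  open import Data.Sum using (_⊎_; inj₁; inj₂) renaming (map to ⊎-map)
  open import Function using (id; _∘_)
  open import Function.Bundles using (Equivalence)
  open import Relation.Binary.PropositionalEquality
  open import Relation.Nullary using (¬_)
  open import Relation.Nullary.Decidable using (_×-dec_)
  open import Defs using (GB; N-GB)
  open FiniteSums
  open PairCounting
  open Folding
  open Thresholds
  open Equivalence using (to; from)
  open ≡-Reasoning

  GB′ : ℕ → ℕ → ℕ → ℕ
  GB′ h a b = (h + a ⊓ b) ⊓ (suc (h + h) ∸ (a ⊔ b))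

  half : ∀ h → (suc (h + h) ∸ 1) / 2 ≡ h
  half h = trans (cong (_/ 2) (trans (cong (h +_) (sym (+-identityʳ h))) (*-comm 2 h))) (m*n/n≡m h 2)

  GB≡ : ∀ h j k → j ≤ suc (h + h) → k ≤ suc (h + h) →
    GB (suc (h + h)) j k ≡ GB′ h (dist (suc (h + h)) j) (dist (suc (h + h)) k)
  GB≡ h j k j≤p k≤p rewrite half h | α≡ (suc (h + h)) j k | δ₁≡ (suc (h + h)) j k j≤p k≤p = refl

  N-GB-folded : ∀ h →
    N-GB (suc (h + h)) ≡ 4 * ∑² h (λ a b → χ (3 * GB′ h (suc a) (suc b) ≤? 2 * suc (h + h)))
  N-GB-folded h = trans (count-pairs _ (h + h)) (∑²-fold h
    (λ j k → χ (3 * GB (suc (h + h)) j k ≤? 2 * suc (h + h)))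
    (λ a b → χ (3 * GB′ h a b ≤? 2 * suc (h + h)))
    (λ j k j≤p k≤p → cong (λ z → χ (3 * z ≤? 2 * suc (h + h))) (GB≡ h j k j≤p k≤p)))

  InInterval : ℕ → ℕ → ℕ → Set
  InInterval g M x = g < x × x ≤ M

  outside-square : ∀ {g M a b} → (a ⊓ b ≤ g ⊎ M < a ⊔ b) →
    ¬ (InInterval g M a × InInterval g M b)
  outside-square (inj₁ u≤g) ((g<a , _) , (g<b , _)) = <⇒≱ (⊓-glb g<a g<b) u≤g
  outside-square (inj₂ M<v) ((_ , a≤M) , (_ , b≤M)) = <⇒≱ M<v (⊔-lub a≤M b≤M)

  inside-square : ∀ {g M a b} → ¬ (a ⊓ b ≤ g ⊎ M < a ⊔ b) → InInterval g M a × InInterval g M b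
  inside-square {g} {M} {a} {b} neither =
    (≤-trans g<u (m⊓n≤m a b) , ≤-trans (m≤m⊔n a b) v≤M) ,
    (≤-trans g<u (m⊓n≤n a b) , ≤-trans (m≤n⊔m a b) v≤M)
    where
    g<u = ≰⇒> (neither ∘ inj₁)
    v≤M = ≮⇒≥ (neither ∘ inj₂)

  -- Main count: with M = ⌊(p - 1)/3⌋ = g + d and T = ⌊2p/3⌋ = h + g, the pairs
  -- with GB > 2p/3 are those whose distances both lie in (g, M], a square of side d.
  GB-count : ∀ h g d {M T} → Third M (h + h) → Third T (2 * suc (h + h)) →
    M ≡ g + d → T ≡ h + g → N-GB (suc (h + h)) + 4 * (d * d) ≡ 4 * (h * h)
  GB-count h g d M-third T-third refl refl = begin
    N-GB p + 4 * (d * d)     ≡⟨ cong (λ z → N-GB p + 4 * z) square-size ⟨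
    N-GB p + 4 * ∑² h square ≡⟨ count-by-complement h 4 (N-GB p) _ square (N-GB-folded h) small? square≤1 ⟩
    4 * (h * h)              ∎
    where
    open Comparisons M-third T-third
    p = suc (h + h)
    M = g + d
    in? = λ x → (g <? x) ×-dec (x ≤? M)
    square : ℕ → ℕ → ℕ
    square a b = χ (in? (suc a)) * χ (in? (suc b))
    square≤1 : ∀ a b → square a b ≤ 1
    square≤1 a b = *-mono-≤ (χ≤1 (in? (suc a))) (χ≤1 (in? (suc b)))
    side : ∑ h (λ a → χ (in? (suc a))) ≡ d
    side = begin
      ∑ h (λ a → χ (in? (suc a)))  ≡⟨ ∑-truncate M h (third-of-double M-third) above-g beyond-M ⟩
      ∑ M (λ i → χ (g ≤? i))       ≡⟨ count-≥ M g ⟩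
      M ∸ g                        ≡⟨ m+n∸m≡n g d ⟩
      d                            ∎
      where
      above-g : ∀ i → i < M → χ (in? (suc i)) ≡ χ (g ≤? i)
      above-g i i<M = χ-cong _ _ (λ (g<1+i , _) → s≤s⁻¹ g<1+i) (λ g≤i → s≤s g≤i , i<M)
      beyond-M : ∀ i → M ≤ i → χ (in? (suc i)) ≡ 0
      beyond-M i M≤i = χ-no _ (λ (_ , i<M) → <⇒≱ i<M M≤i)
    square-size : ∑² h square ≡ d * d
    square-size = trans (∑²-product h _) (cong (λ z → z * z) side)
    small? : ∀ a b → χ (3 * GB′ h (suc a) (suc b) ≤? 2 * p) ≡ 1 ∸ square a b
    small? a b = trans
      (χ-complement _ (in? A ×-dec in? B) (outside-square ∘ cases) (inside-square ∘ (_∘ uncases)))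
      (cong (1 ∸_) (χ-× (in? A) (in? B)))
      where
      A = suc a
      B = suc b
      cases : 3 * GB′ h A B ≤ 2 * p → A ⊓ B ≤ g ⊎ M < A ⊔ B
      cases le = ⊎-map (+-cancelˡ-≤ h _ _) id (to (min-form (h + A ⊓ B) (A ⊔ B)) le)
      uncases : A ⊓ B ≤ g ⊎ M < A ⊔ B → 3 * GB′ h A B ≤ 2 * p
      uncases c = from (min-form (h + A ⊓ B) (A ⊔ B)) (⊎-map (+-monoʳ-≤ h) id c)

module CountBB where

  open import Data.Nat using (ℕ; suc; _+_; _*_; _∸_; _≤_; _<_; _⊓_; _⊔_; _≤?_; _<?_; s≤s; s≤s⁻¹)
  open import Data.Nat.Properties
  open import Data.Nat.Tactic.RingSolver using (solve-∀)
  open import Data.Product using (_×_; _,_)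
  open import Data.Sum using (inj₁; inj₂)
  open import Function using (_∘_)
  open import Function.Bundles using (Equivalence)
  open import Relation.Binary.PropositionalEquality
  open import Relation.Nullary using (¬_)
  open import Relation.Nullary.Decidable using (_×-dec_)
  open import Defs using (BB; N-BB)
  open FiniteSums
  open PairCounting
  open Folding
  open Thresholds
  open Equivalence using (to; from)
  open ≡-Reasoning

  ω : ℕ → ℕ → ℕ
  ω a b = 2 * (a ⊓ b) + (a ⊔ b)

  BB′ : ℕ → ℕ → ℕ → ℕ
  BB′ h a b = ω a b ⊓ (suc (h + h) ∸ (a ⊔ b))

  N-BB-folded : ∀ h →
    N-BB (suc (h + h)) ≡ 4 * ∑² h (λ a b → χ (3 * BB′ h (suc a) (suc b) ≤? 2 * suc (h + h)))
  N-BB-folded h = trans (count-pairs _ (h + h)) (∑²-fold h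
    (λ j k → χ (3 * BB (suc (h + h)) j k ≤? 2 * suc (h + h)))
    (λ a b → χ (3 * BB′ h a b ≤? 2 * suc (h + h)))
    (λ j k j≤p k≤p → cong (λ z → χ (3 * z ≤? 2 * suc (h + h)))
       (cong₂ (λ x y → (2 * x + y) ⊓ (suc (h + h) ∸ y)) (α≡ _ j k) (δ₁≡ _ j k j≤p k≤p))))

  ∸-∸-combine : ∀ M T u → u ≤ M → 3 * u ≤ T → (M ∸ u) ∸ (T ∸ 3 * u) ≡ (M + 2 * u) ∸ T
  ∸-∸-combine M T u u≤M 3u≤T with m≤n⇒∃[o]m+o≡n u≤M | m≤n⇒∃[o]m+o≡n 3u≤T
  ... | r , refl | s , refl = begin
    ((u + r) ∸ u) ∸ ((3 * u + s) ∸ 3 * u) ≡⟨ cong₂ _∸_ (m+n∸m≡n u r) (m+n∸m≡n (3 * u) s) ⟩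
    r ∸ s                                  ≡⟨ [m+n]∸[m+o]≡n∸o (3 * u) r s ⟨
    (3 * u + r) ∸ (3 * u + s)              ≡⟨ cong (_∸ (3 * u + s)) (regroup u r) ⟩
    (u + r + 2 * u) ∸ (3 * u + s)          ∎
    where
    regroup : ∀ u r → 3 * u + r ≡ u + r + 2 * u
    regroup = solve-∀

  -- The pairs (a, b) ∈ [1, M]² with ω a b > T, where M = κ + n₁ + n₂ and T = M + 2κ,
  -- form a staircase, counted hook by hook along the diagonal.
  module Staircase (κ n₁ n₂ : ℕ) where

    M = κ + n₁ + n₂
    T = M + 2 * κ

    -- the indicator of ω > T on [1, M]², shifted to [0, M)²
    exceeds : ℕ → ℕ → ℕ
    exceeds i j = χ (T <? ω (suc i) (suc j))

    -- the size of the hook at the diagonal point (u, u)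
    hook : ℕ → ℕ
    hook u = χ (T <? 3 * u) + 2 * ((M ∸ u) ∸ (T ∸ 3 * u))

    ω-diagonal : ∀ u → ω u u ≡ 3 * u
    ω-diagonal u = trans (cong₂ (λ x y → 2 * x + y) (⊓-idem u) (⊔-idem u)) (sym (triple u))
      where
      triple : ∀ u → 3 * u ≡ 2 * u + u
      triple = solve-∀

    ω-right : ∀ u j → ω u (suc (u + j)) ≡ suc (3 * u + j)
    ω-right u j = trans (cong₂ (λ x y → 2 * x + y) (m≤n⇒m⊓n≡m u≤) (m≤n⇒m⊔n≡n u≤)) (regroup u j)
      where
      u≤ = ≤-trans (m≤m+n u j) (n≤1+n _)
      regroup : ∀ u j → 2 * u + suc (u + j) ≡ suc (3 * u + j)
      regroup = solve-∀

    -- the staircase is symmetric, so it is the sum of its hooks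
    ∑²-exceeds≡hooks : ∑² M exceeds ≡ ∑ M (λ i → hook (suc i))
    ∑²-exceeds≡hooks = trans (∑²-hooks M exceeds exceeds-sym)
      (∑-cong M (λ i _ → cong₂ _+_ diagonal (cong (2 *_) (row i))))
      where
      exceeds-sym : ∀ i j → exceeds i j ≡ exceeds j i
      exceeds-sym i j = cong₂ (λ x y → χ (T <? 2 * x + y)) (⊓-comm (suc i) (suc j)) (⊔-comm (suc i) (suc j))
      diagonal : ∀ {i} → exceeds i i ≡ χ (T <? 3 * suc i)
      diagonal {i} = cong (λ z → χ (T <? z)) (ω-diagonal (suc i))
      row : ∀ i → ∑ (M ∸ suc i) (λ j → exceeds i (suc i + j)) ≡ (M ∸ suc i) ∸ (T ∸ 3 * suc i)
      row i = trans (∑-cong (M ∸ u) (λ j _ → χ-cong _ _ to-≤ from-≤)) (count-≥ (M ∸ u) (T ∸ 3 * u))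
        where
        u = suc i
        to-≤ : ∀ {j} → T < ω u (suc (u + j)) → T ∸ 3 * u ≤ j
        to-≤ {j} lt = m≤n+o⇒m∸n≤o T (3 * u) (s≤s⁻¹ (subst (T <_) (ω-right u j) lt))
        from-≤ : ∀ {j} → T ∸ 3 * u ≤ j → T < ω u (suc (u + j))
        from-≤ {j} le = subst (T <_) (sym (ω-right u j))
          (s≤s (≤-trans (m≤n+m∸n T (3 * u)) (+-monoʳ-≤ (3 * u) le)))

    -- Below the cut 3u ≤ T only the arms count, and they are empty up to κ.
    hook-low : ∀ u → 3 * u ≤ T → u ≤ M → hook u ≡ 2 * (2 * (u ∸ κ))
    hook-low u 3u≤T u≤M = begin
      χ (T <? 3 * u) + 2 * ((M ∸ u) ∸ (T ∸ 3 * u))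
        ≡⟨ cong₂ (λ x y → x + 2 * y) (χ-no (T <? 3 * u) (<⇒≱′ 3u≤T)) (∸-∸-combine M T u u≤M 3u≤T) ⟩
      2 * ((M + 2 * u) ∸ (M + 2 * κ))
        ≡⟨ cong (2 *_) ([m+n]∸[m+o]≡n∸o M (2 * u) (2 * κ)) ⟩
      2 * (2 * u ∸ 2 * κ)
        ≡⟨ cong (2 *_) (*-distribˡ-∸ 2 u κ) ⟨
      2 * (2 * (u ∸ κ)) ∎
      where
      <⇒≱′ : 3 * u ≤ T → ¬ (T < 3 * u)
      <⇒≱′ le lt = <⇒≱ lt le

    hook-high : ∀ u → T < 3 * u → hook u ≡ 1 + 2 * (M ∸ u)
    hook-high u T<3u =
      cong₂ (λ x y → x + 2 * ((M ∸ u) ∸ y)) (χ-yes (T <? 3 * u) T<3u) (m≤n⇒m∸n≡0 (<⇒≤ T<3u))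

    -- With T = 3(κ + n₁) + c the hooks vanish for u ≤ κ, are arms of length 2(u - κ)
    -- for κ < u ≤ κ + n₁, and are full (diagonal point included) beyond.
    staircase : ∀ c → T ≡ 3 * (κ + n₁) + c → c < 3 →
      ∑² M exceeds ≡ 2 * (n₁ * (n₁ + 1)) + n₂ * n₂
    staircase c T≡ c<3 = begin
      ∑² M exceeds
        ≡⟨ ∑²-exceeds≡hooks ⟩
      ∑ (κ + n₁ + n₂) (λ i → hook (suc i))
        ≡⟨ ∑-split (κ + n₁) n₂ _ ⟩
      ∑ (κ + n₁) (λ i → hook (suc i)) + ∑ n₂ (λ t → hook (suc (κ + n₁ + t)))
        ≡⟨ cong (_+ ∑ n₂ (λ t → hook (suc (κ + n₁ + t)))) (∑-split κ n₁ _) ⟩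
      (∑ κ (λ i → hook (suc i)) + ∑ n₁ (λ t → hook (suc (κ + t))))
        + ∑ n₂ (λ t → hook (suc (κ + n₁ + t)))
        ≡⟨ cong₂ _+_ (cong₂ _+_ (∑-vanishes κ empty-hooks) (∑-cong n₁ arm-hooks))
                     (∑-cong n₂ full-hooks) ⟩
      ∑ n₁ (λ t → 2 * (2 * suc t)) + ∑ n₂ (λ t → 1 + 2 * (n₂ ∸ suc t))
        ≡⟨ cong₂ _+_ (trans (∑-* n₁ 2 _) (cong (2 *_) (trans (∑-* n₁ 2 suc) (∑-triangle n₁))))
                     (trans (∑-reverse n₂ (λ i → 1 + 2 * i)) (∑-odd n₂)) ⟩
      2 * (n₁ * (n₁ + 1)) + n₂ * n₂ ∎
      where
      cut : ∀ {u} → u ≤ κ + n₁ → 3 * u ≤ T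
      cut u≤ = ≤-trans (*-monoʳ-≤ 3 u≤) (subst (3 * (κ + n₁) ≤_) (sym T≡) (m≤m+n _ c))
      ≤M : ∀ {u} → u ≤ κ + n₁ → u ≤ M
      ≤M u≤ = ≤-trans u≤ (m≤m+n (κ + n₁) n₂)
      empty-hooks : ∀ i → i < κ → hook (suc i) ≡ 0
      empty-hooks i i<κ =
        trans (hook-low (suc i) (cut u≤) (≤M u≤)) (cong (λ z → 2 * (2 * z)) (m≤n⇒m∸n≡0 i<κ))
        where u≤ = ≤-trans i<κ (m≤m+n κ n₁)
      arm-hooks : ∀ t → t < n₁ → hook (suc (κ + t)) ≡ 2 * (2 * suc t)
      arm-hooks t t<n₁ = trans (hook-low _ (cut u≤) (≤M u≤)) (cong (λ z → 2 * (2 * z)) u∸κ)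
        where
        u≤ : suc (κ + t) ≤ κ + n₁
        u≤ = subst (_≤ κ + n₁) (+-suc κ t) (+-monoʳ-≤ κ t<n₁)
        u∸κ : suc (κ + t) ∸ κ ≡ suc t
        u∸κ = trans (cong (_∸ κ) (sym (+-suc κ t))) (m+n∸m≡n κ (suc t))
      full-hooks : ∀ t → t < n₂ → hook (suc (κ + n₁ + t)) ≡ 1 + 2 * (n₂ ∸ suc t)
      full-hooks t _ = trans (hook-high (suc (κ + n₁ + t)) above) (cong (λ z → 1 + 2 * z) M∸u)
        where
        above : T < 3 * suc (κ + n₁ + t)
        above = ≤-trans (subst (_< 3 * suc (κ + n₁)) (sym T≡) T<3[κ+n₁+1])
                        (*-monoʳ-≤ 3 (s≤s (m≤m+n (κ + n₁) t)))
          where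
          T<3[κ+n₁+1] : 3 * (κ + n₁) + c < 3 * suc (κ + n₁)
          T<3[κ+n₁+1] = subst (3 * (κ + n₁) + c <_) (trans (+-comm _ 3) (sym (*-suc 3 _))) (+-monoʳ-< _ c<3)
        M∸u : M ∸ suc (κ + n₁ + t) ≡ n₂ ∸ suc t
        M∸u = trans (cong (M ∸_) (sym (+-suc (κ + n₁) t))) ([m+n]∸[m+o]≡n∸o (κ + n₁) n₂ (suc t))

  -- Main count: with M = ⌊(p - 1)/3⌋ = κ + n₁ + n₂ and T = ⌊2p/3⌋ = M + 2κ, the pairs
  -- with BB > 2p/3 are those whose distances lie in [1, M] and form the staircase above T.
  BB-count : ∀ h κ n₁ n₂ c {M T} → Third M (h + h) → Third T (2 * suc (h + h)) →
    M ≡ κ + n₁ + n₂ → T ≡ M + 2 * κ → T ≡ 3 * (κ + n₁) + c → c < 3 →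
    N-BB (suc (h + h)) + 4 * (2 * (n₁ * (n₁ + 1)) + n₂ * n₂) ≡ 4 * (h * h)
  BB-count h κ n₁ n₂ c M-third T-third refl refl T≡ c<3 = begin
    N-BB p + 4 * (2 * (n₁ * (n₁ + 1)) + n₂ * n₂)
      ≡⟨ cong (λ z → N-BB p + 4 * z) (trans restrict (staircase c T≡ c<3)) ⟨
    N-BB p + 4 * ∑² h Z
      ≡⟨ count-by-complement h 4 (N-BB p) _ Z (N-BB-folded h) small? Z≤1 ⟩
    4 * (h * h) ∎
    where
    open Staircase κ n₁ n₂
    open Comparisons M-third T-third
    p = suc (h + h)
    Z? = λ a b → (a ≤? M) ×-dec ((b ≤? M) ×-dec (T <? ω a b))
    Z : ℕ → ℕ → ℕ
    Z a b = χ (Z? (suc a) (suc b))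
    Z≤1 : ∀ a b → Z a b ≤ 1
    Z≤1 a b = χ≤1 (Z? (suc a) (suc b))
    M≤h = third-of-double M-third
    restrict : ∑² h Z ≡ ∑² M exceeds
    restrict = ∑-truncate M h M≤h
      (λ i i<M → ∑-truncate M h M≤h
        (λ j j<M → χ-cong _ _ (λ (_ , _ , T<ω) → T<ω) (λ T<ω → i<M , j<M , T<ω))
        (λ j M≤j → χ-no _ (λ (_ , j<M , _) → <⇒≱ j<M M≤j)))
      (λ i M≤i → ∑-vanishes h (λ j _ → χ-no _ (λ (i<M , _) → <⇒≱ i<M M≤i)))
    small? : ∀ a b → χ (3 * BB′ h (suc a) (suc b) ≤? 2 * p) ≡ 1 ∸ Z a b
    small? a b = χ-complement _ (Z? A B) outside inside
      where
      A = suc a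
      B = suc b
      outside : 3 * BB′ h A B ≤ 2 * p → ¬ (A ≤ M × B ≤ M × T < ω A B)
      outside le (A≤M , B≤M , T<ω) with to (min-form (ω A B) (A ⊔ B)) le
      ... | inj₁ ω≤T = <⇒≱ T<ω ω≤T
      ... | inj₂ M<v = <⇒≱ M<v (⊔-lub A≤M B≤M)
      inside : ¬ (3 * BB′ h A B ≤ 2 * p) → A ≤ M × B ≤ M × T < ω A B
      inside large =
        ≤-trans (m≤m⊔n A B) v≤M , ≤-trans (m≤n⊔m A B) v≤M , ≰⇒> (large ∘ from form ∘ inj₁)
        where
        form = min-form (ω A B) (A ⊔ B)
        v≤M = ≮⇒≥ (large ∘ from form ∘ inj₂)

module ResidueClasses where

  open import Data.Nat using (ℕ; suc; _+_; _*_; _≤_; _<_; s≤s; z≤n; NonTrivial)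
  open import Data.Nat.Properties using (≤-trans; n≤1+n)
  open import Data.Nat.DivMod using (_%_; _/_; m%n<n; m≡m%n+[m/n]*n)
  open import Data.Nat.Divisibility using (_∣_; divides; hasNonTrivialDivisor)
  open import Data.Nat.Primality using (Prime; prime⇒¬composite)
  open import Data.Nat.Tactic.RingSolver using (solve-∀)
  open import Data.Empty using (⊥; ⊥-elim)
  open import Data.Product using (Σ; _×_; _,_)
  open import Relation.Binary.PropositionalEquality
  open import Defs using (N-GB; N-BB)
  open Thresholds
  open CountGB
  open CountBB

  h+h≡3M+e : ∀ d e → (3 * d + 2 * e) + (3 * d + 2 * e) ≡ 3 * (2 * d + e) + e
  h+h≡3M+e = solve-∀

  -- For p = 6d + 4e + 1 with e ∈ {0, 1}, i.e. p = 2h + 1 with h = 3d + 2e: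
  -- ⌊(p - 1)/3⌋ = 2d + e and ⌊2p/3⌋ = 4d + 3e.
  thirds : ∀ d e → e ≤ 1 →
    Third (2 * d + e) ((3 * d + 2 * e) + (3 * d + 2 * e)) ×
    Third (4 * d + 3 * e) (2 * suc ((3 * d + 2 * e) + (3 * d + 2 * e)))
  thirds d 0 _ = third-intro 0 (h+h≡3M+e d 0) (s≤s z≤n) , third-intro 2 (form₂ d) (s≤s (s≤s (s≤s z≤n)))
    where
    form₂ : ∀ d → 2 * suc ((3 * d + 2 * 0) + (3 * d + 2 * 0)) ≡ 3 * (4 * d + 3 * 0) + 2
    form₂ = solve-∀
  thirds d 1 _ = third-intro 1 (h+h≡3M+e d 1) (s≤s (s≤s z≤n)) , third-intro 1 (form₂ d) (s≤s (s≤s z≤n))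
    where
    form₂ : ∀ d → 2 * suc ((3 * d + 2 * 1) + (3 * d + 2 * 1)) ≡ 3 * (4 * d + 3 * 1) + 1
    form₂ = solve-∀
  thirds d (suc (suc _)) (s≤s ())

  -- The GB count for p = 6d + 4e + 1: here g = d + e.
  GB-at : ∀ d e → e ≤ 1 →
    N-GB (4 * e + 1 + 6 * d) + 4 * (d * d) ≡ 4 * ((3 * d + 2 * e) * (3 * d + 2 * e))
  GB-at d e e≤1 = subst (λ p → N-GB p + 4 * (d * d) ≡ 4 * (h * h)) (sym (p≡ d e))
    (GB-count h (d + e) d M-third T-third (M≡ d e) (T≡ d e))
    where
    h = 3 * d + 2 * e
    open Σ (thirds d e e≤1) renaming (proj₁ to M-third; proj₂ to T-third)
    p≡ : ∀ d e → 4 * e + 1 + 6 * d ≡ suc ((3 * d + 2 * e) + (3 * d + 2 * e))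
    p≡ = solve-∀
    M≡ : ∀ d e → 2 * d + e ≡ (d + e) + d
    M≡ = solve-∀
    T≡ : ∀ d e → 4 * d + 3 * e ≡ (3 * d + 2 * e) + (d + e)
    T≡ = solve-∀

  -- The BB count for p = 18n + 6c + 4e + 1, i.e. d = 3n + c: here κ = d + e, n₁ = n, n₂ = 2n + c.
  BB-at : ∀ c e n → c < 3 → e ≤ 1 →
    N-BB (6 * c + 4 * e + 1 + 18 * n) + 4 * (2 * (n * (n + 1)) + (2 * n + c) * (2 * n + c))
      ≡ 4 * ((3 * (3 * n + c) + 2 * e) * (3 * (3 * n + c) + 2 * e))
  BB-at c e n c<3 e≤1 = subst (λ p → N-BB p + 4 * Q ≡ 4 * (h * h)) (sym (p≡ c e n))
    (BB-count h (3 * n + c + e) n (2 * n + c) c M-third T-third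
      (M≡ c e n) (T≡M+2κ c e n) (T≡3[κ+n₁]+c c e n) c<3)
    where
    h = 3 * (3 * n + c) + 2 * e
    Q = 2 * (n * (n + 1)) + (2 * n + c) * (2 * n + c)
    open Σ (thirds (3 * n + c) e e≤1) renaming (proj₁ to M-third; proj₂ to T-third)
    p≡ : ∀ c e n →
      6 * c + 4 * e + 1 + 18 * n ≡ suc ((3 * (3 * n + c) + 2 * e) + (3 * (3 * n + c) + 2 * e))
    p≡ = solve-∀
    M≡ : ∀ c e n → 2 * (3 * n + c) + e ≡ (3 * n + c + e) + n + (2 * n + c)
    M≡ = solve-∀
    T≡M+2κ : ∀ c e n → 4 * (3 * n + c) + 3 * e ≡ (2 * (3 * n + c) + e) + 2 * (3 * n + c + e)
    T≡M+2κ = solve-∀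
    T≡3[κ+n₁]+c : ∀ c e n → 4 * (3 * n + c) + 3 * e ≡ 3 * ((3 * n + c + e) + n) + c
    T≡3[κ+n₁]+c = solve-∀

  record Mod6Form (p : ℕ) : Set where
    field
      e d : ℕ
      e≤1 : e ≤ 1
      p≡ : p ≡ 4 * e + 1 + 6 * d

  -- Primes p > 3 are neither even nor divisible by 3.
  prime-mod-6 : ∀ {p} → Prime p → 3 < p → Mod6Form p
  prime-mod-6 {p} p-prime 3<p = classify (p % 6) (m%n<n p 6) (m≡m%n+[m/n]*n p 6)
    where
    q = p / 6
    proper-divisor : ∀ k .{{_ : NonTrivial k}} → k < p → k ∣ p → ⊥
    proper-divisor k k<p k∣p = prime⇒¬composite p-prime (hasNonTrivialDivisor k<p k∣p)
    even-form : ∀ k q → 2 * k + q * 6 ≡ (k + q * 3) * 2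
    even-form = solve-∀
    triple-form : ∀ q → 3 + q * 6 ≡ (1 + q * 2) * 3
    triple-form = solve-∀
    unit-form : ∀ e q → (4 * e + 1) + q * 6 ≡ 4 * e + 1 + 6 * q
    unit-form = solve-∀
    even : ∀ k → p ≡ 2 * k + q * 6 → ⊥
    even k eq = proper-divisor 2 (≤-trans (n≤1+n 3) 3<p) (divides (k + q * 3) (trans eq (even-form k q)))
    classify : ∀ r → r < 6 → p ≡ r + q * 6 → Mod6Form p
    classify 0 _ eq = ⊥-elim (even 0 eq)
    classify 1 _ eq = record { e = 0 ; d = q ; e≤1 = z≤n ; p≡ = trans eq (unit-form 0 q) }
    classify 2 _ eq = ⊥-elim (even 1 eq)
    classify 3 _ eq = ⊥-elim (proper-divisor 3 3<p (divides (1 + q * 2) (trans eq (triple-form q))))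
    classify 4 _ eq = ⊥-elim (even 2 eq)
    classify 5 _ eq = record { e = 1 ; d = q ; e≤1 = s≤s z≤n ; p≡ = trans eq (unit-form 1 q) }
    classify (suc (suc (suc (suc (suc (suc _)))))) (s≤s (s≤s (s≤s (s≤s (s≤s (s≤s ())))))) _


open import Defs
open import Data.Nat using (ℕ; _<_; _%_)
open import Data.Nat.Primality using (Prime)
open import Data.Integer using (+_)
open import Data.Rational using (ℚ; _/_; _+_; _-_; _*_)
open import Data.Product using (_×_)
open import Data.Sum using (_⊎_)
open import Relation.Binary.PropositionalEquality using (_≡_)
open import Relation.Nullary using (¬_)

import Data.Nat as ℕ
open import Data.Nat using (_≤_; s≤s)
open import Data.Nat.DivMod using (m≡m%n+[m/n]*n; m%n<n; %-remove-+ʳ)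
open import Data.Nat.Divisibility using (divides; ∣m⇒∣m*n; n∣m*n)
open import Data.Nat.Tactic.RingSolver using (solve-∀)
open import Data.Integer as ℤ using (-_)
import Data.Integer.Properties as ℤ
open import Data.Rational using (mkℚ)
open import Data.Rational.Properties using (normalize-coprime)
open import Data.Rational.Solver using (module +-*-Solver)
open +-*-Solver using (Polynomial; solve; var; con; _:+_; _:*_; _:-_; _:=_)
open import Data.Nat.Coprimality using (1-coprimeTo) renaming (sym to coprime-sym)
open import Data.Product using (_,_)
open import Data.Sum using (inj₁; inj₂)
open import Data.Empty using (⊥-elim)
open import Relation.Nullary.Negation using (contradiction)
open import Data.Fin using (zero)
open import Relation.Binary.PropositionalEquality using (refl; sym; trans; cong; cong₂; subst; module ≡-Reasoning)
open ResidueClasses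

ι : ℕ → ℚ
ι n = + n / 1

ι≡mkℚ : ∀ n → ι n ≡ mkℚ (+ n) 0 (coprime-sym (1-coprimeTo n))
ι≡mkℚ n = normalize-coprime (coprime-sym (1-coprimeTo n))

ι-+ : ∀ a b → ι (a ℕ.+ b) ≡ ι a + ι b
ι-+ a b = trans (cong (_/ 1) numerator) (sym (cong₂ _+_ (ι≡mkℚ a) (ι≡mkℚ b)))
  where
  numerator : + (a ℕ.+ b) ≡ + a ℤ.* + 1 ℤ.+ + b ℤ.* + 1
  numerator = trans (ℤ.pos-+ a b) (sym (cong₂ ℤ._+_ (ℤ.*-identityʳ (+ a)) (ℤ.*-identityʳ (+ b))))

ι-* : ∀ a b → ι (a ℕ.* b) ≡ ι a * ι b
ι-* a b = trans (cong (_/ 1) (ℤ.pos-* a b)) (sym (cong₂ _*_ (ι≡mkℚ a) (ι≡mkℚ b)))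

-- Polynomials in one variable with natural coefficients, read in ℕ, in ℚ, and as
-- input to the ℚ ring solver; ι commutes with their evaluation.
data Expr : Set where
  x̂ : Expr
  #_ : ℕ → Expr
  _⊕_ _⊗_ : Expr → Expr → Expr

infixl 6 _⊕_
infixl 7 _⊗_
infix 8 #_

⟦_⟧ℕ : Expr → ℕ → ℕ
⟦ x̂ ⟧ℕ     x = x
⟦ # n ⟧ℕ   x = n
⟦ a ⊕ b ⟧ℕ x = ⟦ a ⟧ℕ x ℕ.+ ⟦ b ⟧ℕ x
⟦ a ⊗ b ⟧ℕ x = ⟦ a ⟧ℕ x ℕ.* ⟦ b ⟧ℕ x

⟦_⟧ℚ : Expr → ℚ → ℚ
⟦ x̂ ⟧ℚ     y = y
⟦ # n ⟧ℚ   y = ι n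
⟦ a ⊕ b ⟧ℚ y = ⟦ a ⟧ℚ y + ⟦ b ⟧ℚ y
⟦ a ⊗ b ⟧ℚ y = ⟦ a ⟧ℚ y * ⟦ b ⟧ℚ y

⌜_⌝ : Expr → Polynomial 1
⌜ x̂ ⌝     = var zero
⌜ # n ⌝   = con (ι n)
⌜ a ⊕ b ⌝ = ⌜ a ⌝ :+ ⌜ b ⌝
⌜ a ⊗ b ⌝ = ⌜ a ⌝ :* ⌜ b ⌝

ι-⟦⟧ : ∀ e x → ι (⟦ e ⟧ℕ x) ≡ ⟦ e ⟧ℚ (ι x)
ι-⟦⟧ x̂       x = refl
ι-⟦⟧ (# n)   x = refl
ι-⟦⟧ (a ⊕ b) x = trans (ι-+ (⟦ a ⟧ℕ x) (⟦ b ⟧ℕ x)) (cong₂ _+_ (ι-⟦⟧ a x) (ι-⟦⟧ b x))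
ι-⟦⟧ (a ⊗ b) x = trans (ι-* (⟦ a ⟧ℕ x) (⟦ b ⟧ℕ x)) (cong₂ _*_ (ι-⟦⟧ a x) (ι-⟦⟧ b x))

transfer : ∀ N x (A B P : Expr) (F : ℚ → ℚ) → N ℕ.+ ⟦ A ⟧ℕ x ≡ ⟦ B ⟧ℕ x →
  (∀ y → ⟦ B ⟧ℚ y - ⟦ A ⟧ℚ y ≡ F (⟦ P ⟧ℚ y)) → ι N ≡ F (ι (⟦ P ⟧ℕ x))
transfer N x A B P F count identity = begin
  ι N                         ≡⟨ add-sub (ι N) (ι a) ⟩
  (ι N + ι a) - ι a           ≡⟨ cong (_- ι a) (ι-+ N a) ⟨
  ι (N ℕ.+ a) - ι a           ≡⟨ cong₂ _-_ (trans (cong ι count) (ι-⟦⟧ B x)) (ι-⟦⟧ A x) ⟩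
  ⟦ B ⟧ℚ (ι x) - ⟦ A ⟧ℚ (ι x) ≡⟨ identity (ι x) ⟩
  F (⟦ P ⟧ℚ (ι x))            ≡⟨ cong F (ι-⟦⟧ P x) ⟨
  F (ι (⟦ P ⟧ℕ x))            ∎
  where
  open ≡-Reasoning
  a = ⟦ A ⟧ℕ x
  add-sub : ∀ n a → n ≡ (n + a) - a
  add-sub = solve 2 (λ n a → n := (n :+ a) :- a) refl

gb₁ gb₂ : ℚ → ℚ
gb₁ P = (+ 8 / 9) * P * P - (+ 16 / 9) * P + + 8 / 9
gb₂ P = (+ 8 / 9) * P * P - (+ 8 / 9) * P - + 16 / 9

bb : ℚ → ℚ → ℚ → ℚ
bb K L P = (+ 25 / 27) * P * P - ((+ 8 / 27) * L + + 2 / 1) * P + K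

gb₁ˢ gb₂ˢ : Polynomial 1 → Polynomial 1
gb₁ˢ P = con (+ 8 / 9) :* P :* P :- con (+ 16 / 9) :* P :+ con (+ 8 / 9)
gb₂ˢ P = con (+ 8 / 9) :* P :* P :- con (+ 8 / 9) :* P :- con (+ 16 / 9)

bbˢ : ℚ → ℚ → Polynomial 1 → Polynomial 1
bbˢ K L P = con (+ 25 / 27) :* P :* P :- (con (+ 8 / 27) :* con L :+ con (+ 2 / 1)) :* P :+ con K

GB-claims : ℕ → Set
GB-claims p = (p % 3 ≡ 1 → ι (N-GB p) ≡ gb₁ (ι p)) × (p % 3 ≡ 2 → ι (N-GB p) ≡ gb₂ (ι p))

BB-claims : ℕ → Set
BB-claims p = (p % 9 ≡ 2 ⊎ p % 9 ≡ 7 → ι (N-BB p) ≡ bb (+ 73 / 27) (legendre3 p / 1) (ι p))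
            × (¬ (p % 9 ≡ 2 ⊎ p % 9 ≡ 7) → ι (N-BB p) ≡ bb (+ 37 / 27) (legendre3 p / 1) (ι p))

-- The GB count for p = 6d + 4e + 1 as polynomials in d: 4d², 4h² with h = 3d + 2e, and p.
4d² : Expr
4d² = # 4 ⊗ (x̂ ⊗ x̂)

4h²ᴳ pᴳ : ℕ → Expr
4h²ᴳ e = # 4 ⊗ ((# 3 ⊗ x̂ ⊕ # 2 ⊗ # e) ⊗ (# 3 ⊗ x̂ ⊕ # 2 ⊗ # e))
pᴳ e = # 4 ⊗ # e ⊕ # 1 ⊕ # 6 ⊗ x̂

-- p ≡ 4e + 1 (mod 3) decides which of the two GB claims applies.
mod-3ᴳ : ∀ e d → (4 ℕ.* e ℕ.+ 1 ℕ.+ 6 ℕ.* d) % 3 ≡ (4 ℕ.* e ℕ.+ 1) % 3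
mod-3ᴳ e d = %-remove-+ʳ (4 ℕ.* e ℕ.+ 1) (∣m⇒∣m*n d (divides 2 refl))

GB-claims-hold : ∀ e d → e ≤ 1 → GB-claims (4 ℕ.* e ℕ.+ 1 ℕ.+ 6 ℕ.* d)
GB-claims-hold 0 d e≤1 = (λ _ → closed) , (λ p%3≡2 → contradiction (trans (sym (mod-3ᴳ 0 d)) p%3≡2) λ ())
  where
  closed = transfer (N-GB (1 ℕ.+ 6 ℕ.* d)) d 4d² (4h²ᴳ 0) (pᴳ 0) gb₁ (GB-at d 0 e≤1)
             (solve 1 (λ _ → ⌜ 4h²ᴳ 0 ⌝ :- ⌜ 4d² ⌝ := gb₁ˢ ⌜ pᴳ 0 ⌝) refl)
GB-claims-hold 1 d e≤1 = (λ p%3≡1 → contradiction (trans (sym (mod-3ᴳ 1 d)) p%3≡1) λ ()) , (λ _ → closed)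
  where
  closed = transfer (N-GB (5 ℕ.+ 6 ℕ.* d)) d 4d² (4h²ᴳ 1) (pᴳ 1) gb₂ (GB-at d 1 e≤1)
             (solve 1 (λ _ → ⌜ 4h²ᴳ 1 ⌝ :- ⌜ 4d² ⌝ := gb₂ˢ ⌜ pᴳ 1 ⌝) refl)
GB-claims-hold (ℕ.suc (ℕ.suc _)) d (s≤s ())

-- The BB count for p = 6c + 4e + 1 + 18n as polynomials in n:
-- 4(2n(n + 1) + (2n + c)²), 4h² with h = 3(3n + c) + 2e, and p.
4Qᴮ : ℕ → Expr
4Qᴮ c = # 4 ⊗ (# 2 ⊗ (x̂ ⊗ (x̂ ⊕ # 1)) ⊕ (# 2 ⊗ x̂ ⊕ # c) ⊗ (# 2 ⊗ x̂ ⊕ # c))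

4h²ᴮ pᴮ : ℕ → ℕ → Expr
4h²ᴮ c e = # 4 ⊗ (h ⊗ h) where h = # 3 ⊗ (# 3 ⊗ x̂ ⊕ # c) ⊕ # 2 ⊗ # e
pᴮ c e = # 6 ⊗ # c ⊕ # 4 ⊗ # e ⊕ # 1 ⊕ # 18 ⊗ x̂

-- The constant term (by the class of p mod 9) and the Legendre symbol (by p mod 3).
Kᶜ : ℕ → ℚ
Kᶜ 1 = + 73 / 27
Kᶜ _ = + 37 / 27

Lᵉ : ℕ → ℤ.ℤ
Lᵉ 0 = + 1
Lᵉ _ = - + 1

BB-ring-identity : ℕ → ℕ → Polynomial 1 × Polynomial 1
BB-ring-identity c e = ⌜ 4h²ᴮ c e ⌝ :- ⌜ 4Qᴮ c ⌝ := bbˢ (Kᶜ c) (Lᵉ e / 1) ⌜ pᴮ c e ⌝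

N-BB-closed : ∀ c e n → c < 3 → e ≤ 1 →
  ι (N-BB (⟦ pᴮ c e ⟧ℕ n)) ≡ bb (Kᶜ c) (Lᵉ e / 1) (ι (⟦ pᴮ c e ⟧ℕ n))
N-BB-closed c e n c<3 e≤1 = transfer (N-BB (⟦ pᴮ c e ⟧ℕ n)) n (4Qᴮ c) (4h²ᴮ c e) (pᴮ c e)
  (bb (Kᶜ c) (Lᵉ e / 1)) (BB-at c e n c<3 e≤1) (identity c e c<3 e≤1)
  where
  identity : ∀ c e → c < 3 → e ≤ 1 →
    ∀ y → ⟦ 4h²ᴮ c e ⟧ℚ y - ⟦ 4Qᴮ c ⟧ℚ y ≡ bb (Kᶜ c) (Lᵉ e / 1) (⟦ pᴮ c e ⟧ℚ y)
  identity 0 0 _ _ = solve 1 (λ _ → BB-ring-identity 0 0) refl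
  identity 0 1 _ _ = solve 1 (λ _ → BB-ring-identity 0 1) refl
  identity 1 0 _ _ = solve 1 (λ _ → BB-ring-identity 1 0) refl
  identity 1 1 _ _ = solve 1 (λ _ → BB-ring-identity 1 1) refl
  identity 2 0 _ _ = solve 1 (λ _ → BB-ring-identity 2 0) refl
  identity 2 1 _ _ = solve 1 (λ _ → BB-ring-identity 2 1) refl
  identity (ℕ.suc (ℕ.suc (ℕ.suc _))) _ (s≤s (s≤s (s≤s ()))) _
  identity _ (ℕ.suc (ℕ.suc _)) _ (s≤s ())

mod-3ᴮ : ∀ c e n → (⟦ pᴮ c e ⟧ℕ n) % 3 ≡ (4 ℕ.* e ℕ.+ 1) % 3
mod-3ᴮ c e n =
  trans (cong (_% 3) (regroup c e n)) (%-remove-+ʳ (4 ℕ.* e ℕ.+ 1) (n∣m*n (2 ℕ.* c ℕ.+ 6 ℕ.* n)))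
  where
  regroup : ∀ c e n →
    6 ℕ.* c ℕ.+ 4 ℕ.* e ℕ.+ 1 ℕ.+ 18 ℕ.* n ≡ 4 ℕ.* e ℕ.+ 1 ℕ.+ (2 ℕ.* c ℕ.+ 6 ℕ.* n) ℕ.* 3
  regroup = solve-∀

mod-9ᴮ : ∀ c e n → (⟦ pᴮ c e ⟧ℕ n) % 9 ≡ (6 ℕ.* c ℕ.+ 4 ℕ.* e ℕ.+ 1) % 9
mod-9ᴮ c e n = %-remove-+ʳ (6 ℕ.* c ℕ.+ 4 ℕ.* e ℕ.+ 1) (∣m⇒∣m*n n (divides 2 refl))

legendre3-1 : ∀ p → p % 3 ≡ 1 → legendre3 p ≡ + 1
legendre3-1 p eq rewrite eq = refl

legendre3-2 : ∀ p → p % 3 ≡ 2 → legendre3 p ≡ - + 1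
legendre3-2 p eq rewrite eq = refl

N-BB-legendre : ∀ c e n → c < 3 → e ≤ 1 →
  ι (N-BB (⟦ pᴮ c e ⟧ℕ n)) ≡ bb (Kᶜ c) (legendre3 (⟦ pᴮ c e ⟧ℕ n) / 1) (ι (⟦ pᴮ c e ⟧ℕ n))
N-BB-legendre c e n c<3 e≤1 =
  subst (λ L → ι (N-BB p) ≡ bb (Kᶜ c) (L / 1) (ι p)) (sym (legendre e e≤1)) (N-BB-closed c e n c<3 e≤1)
  where
  p = ⟦ pᴮ c e ⟧ℕ n
  legendre : ∀ e → e ≤ 1 → legendre3 (⟦ pᴮ c e ⟧ℕ n) ≡ Lᵉ e
  legendre 0 _ = legendre3-1 (⟦ pᴮ c 0 ⟧ℕ n) (mod-3ᴮ c 0 n)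
  legendre 1 _ = legendre3-2 (⟦ pᴮ c 1 ⟧ℕ n) (mod-3ᴮ c 1 n)
  legendre (ℕ.suc (ℕ.suc _)) (s≤s ())

at-±2 : ∀ p r → p % 9 ≡ r % 9 → r % 9 ≡ 2 ⊎ r % 9 ≡ 7 →
  ι (N-BB p) ≡ bb (+ 73 / 27) (legendre3 p / 1) (ι p) → BB-claims p
at-±2 p r p≡r r±2 closed =
  (λ _ → closed) , (λ not-±2 → ⊥-elim (not-±2 (subst (λ x → x ≡ 2 ⊎ x ≡ 7) (sym p≡r) r±2)))

elsewhere : ∀ p r → p % 9 ≡ r % 9 → ¬ (r % 9 ≡ 2 ⊎ r % 9 ≡ 7) →
  ι (N-BB p) ≡ bb (+ 37 / 27) (legendre3 p / 1) (ι p) → BB-claims p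
elsewhere p r p≡r r-not-±2 closed =
  (λ ±2 → ⊥-elim (r-not-±2 (subst (λ x → x ≡ 2 ⊎ x ≡ 7) p≡r ±2))) , (λ _ → closed)

-- The six residue classes of p modulo 18, with r = 6c + 4e + 1.
BB-claims-hold : ∀ c e n → c < 3 → e ≤ 1 → BB-claims (⟦ pᴮ c e ⟧ℕ n)
BB-claims-hold 0 0 n c<3 e≤1 =
  elsewhere (⟦ pᴮ 0 0 ⟧ℕ n) 1 (mod-9ᴮ 0 0 n) (λ { (inj₁ ()) ; (inj₂ ()) }) (N-BB-legendre 0 0 n c<3 e≤1)
BB-claims-hold 0 1 n c<3 e≤1 =
  elsewhere (⟦ pᴮ 0 1 ⟧ℕ n) 5 (mod-9ᴮ 0 1 n) (λ { (inj₁ ()) ; (inj₂ ()) }) (N-BB-legendre 0 1 n c<3 e≤1)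
BB-claims-hold 1 0 n c<3 e≤1 =
  at-±2 (⟦ pᴮ 1 0 ⟧ℕ n) 7 (mod-9ᴮ 1 0 n) (inj₂ refl) (N-BB-legendre 1 0 n c<3 e≤1)
BB-claims-hold 1 1 n c<3 e≤1 =
  at-±2 (⟦ pᴮ 1 1 ⟧ℕ n) 11 (mod-9ᴮ 1 1 n) (inj₁ refl) (N-BB-legendre 1 1 n c<3 e≤1)
BB-claims-hold 2 0 n c<3 e≤1 =
  elsewhere (⟦ pᴮ 2 0 ⟧ℕ n) 13 (mod-9ᴮ 2 0 n) (λ { (inj₁ ()) ; (inj₂ ()) }) (N-BB-legendre 2 0 n c<3 e≤1)
BB-claims-hold 2 1 n c<3 e≤1 =
  elsewhere (⟦ pᴮ 2 1 ⟧ℕ n) 17 (mod-9ᴮ 2 1 n) (λ { (inj₁ ()) ; (inj₂ ()) }) (N-BB-legendre 2 1 n c<3 e≤1)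
BB-claims-hold (ℕ.suc (ℕ.suc (ℕ.suc _))) _ _ (s≤s (s≤s (s≤s ()))) _
BB-claims-hold _ (ℕ.suc (ℕ.suc _)) _ _ (s≤s ())

proposition1 : ∀ (p : ℕ) → Prime p → 3 < p →
    let P : ℚ
        P = + p / 1
        NGB : ℚ
        NGB = + N-GB p / 1
        NBB : ℚ
        NBB = + N-BB p / 1
        L : ℚ
        L = legendre3 p / 1
    in ((p % 3 ≡ 1 → NGB ≡ (+ 8 / 9) * P * P - (+ 16 / 9) * P + + 8 / 9)
       × (p % 3 ≡ 2 → NGB ≡ (+ 8 / 9) * P * P - (+ 8 / 9) * P - + 16 / 9))
       × ((p % 9 ≡ 2 ⊎ p % 9 ≡ 7 →
             NBB ≡ (+ 25 / 27) * P * P - ((+ 8 / 27) * L + + 2 / 1) * P + + 73 / 27)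
         × (¬ (p % 9 ≡ 2 ⊎ p % 9 ≡ 7) →
             NBB ≡ (+ 25 / 27) * P * P - ((+ 8 / 27) * L + + 2 / 1) * P + + 37 / 27))
-- Write p = 6d + 4e + 1 and d = 3n + c; the GB claims follow in terms of d, the BB
-- claims in terms of n.
proposition1 p p-prime 3<p =
  subst GB-claims (sym p≡) (GB-claims-hold e d e≤1) ,
  subst BB-claims (sym p≡pᴮ) (BB-claims-hold (d % 3) e (d ℕ./ 3) (m%n<n d 3) e≤1)
  where
  open Mod6Form (prime-mod-6 p-prime 3<p)
  regroup : ∀ c e n →
    4 ℕ.* e ℕ.+ 1 ℕ.+ 6 ℕ.* (c ℕ.+ n ℕ.* 3) ≡ 6 ℕ.* c ℕ.+ 4 ℕ.* e ℕ.+ 1 ℕ.+ 18 ℕ.* n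
  regroup = solve-∀
  p≡pᴮ : p ≡ ⟦ pᴮ (d % 3) e ⟧ℕ (d ℕ./ 3)
  p≡pᴮ = trans p≡
    (trans (cong (λ x → 4 ℕ.* e ℕ.+ 1 ℕ.+ 6 ℕ.* x) (m≡m%n+[m/n]*n d 3)) (regroup (d % 3) e (d ℕ./ 3)))
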